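{- Let $T$ be a diagram and $i\ge1$ an integer such that $\mathfrak{e}_i(T)\neq0$. Then, for $r\in\{i,i+1\}$, a cell $(c,r)\in T$ is $i$-paired in $T$ if and only if $(c,r)\in\mathfrak{e}_i(T)$ and $(c,r)$ is $i$-paired in $\mathfrak{e}_i(T)$. Moreover, if $\mathfrak{e}_i$ acts on $T$ by moving the cell in position $(c,i+1)$ down to position $(c,i)$, then $(c,i)$ is the leftmost cell in row $i$ of $\mathfrak{e}_i(T)$ that is not $i$-paired.
   Context: A diagram is a finite set of cells $(c,r)$, $c,r$ positive integers ($c$ column, $r$ row, rows numbered from the bottom). For $i\geq1$, the $i$-pairing of cells of a diagram $T$ in rows $i,i+1$ first pairs cells of rows $i$ and $i+1$ lying in the same column, then iteratively pairs an unpaired cell in row $i$ with an unpaired cell in row $i+1$ strictly to its right whenever all cells of rows $i,i+1$ in the columns strictly between them are already paired. The raising operator: $\mathfrak{e}_i(T)=0$ if row $i+1$ has no unpaired cell; otherwise $\mathfrak{e}_i(T)$ is obtained by moving the rightmost unpaired cell of row $i+1$ down to row $i$ within its column, leaving all other cells fixed. -}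

module Defs where

open import Data.Nat using (ℕ; zero; suc; _<ᵇ_; _≡ᵇ_; _≤_; _<_)
open import Data.Bool using (Bool; true; false; _∧_; _∨_; not; if_then_else_)
open import Data.Product using (_×_; _,_; proj₁; proj₂)
open import Data.List using (List; []; _∷_; map; filterᵇ; length; concatMap)
open import Data.Bool.ListAction using (any; all)
open import Data.List.Membership.Propositional using (_∈_)
open import Data.List.Relation.Unary.All using (All)
open import Data.List.Relation.Unary.Unique.Propositional using (Unique)
open import Data.Maybe using (Maybe; just; nothing)
open import Relation.Nullary using (¬_)

-- A cell (c , r): c = column, r = row (rows numbered from the bottom).
Cell : Set
Cell = ℕ × ℕ

col : Cell → ℕ
col = proj₁

rowOf : Cell → ℕ
rowOf = proj₂

Diagram : Set
Diagram = List Cell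

IsDiagram : Diagram → Set
IsDiagram T = Unique T × All (λ x → 1 ≤ col x × 1 ≤ rowOf x) T

eqCellᵇ : Cell → Cell → Bool
eqCellᵇ (a , b) (c , d) = (a ≡ᵇ c) ∧ (b ≡ᵇ d)

_∈ᵇ_ : Cell → List Cell → Bool
x ∈ᵇ xs = any (eqCellᵇ x) xs

rowCols : ℕ → Diagram → List ℕ
rowCols r T = map col (filterᵇ (λ x → rowOf x ≡ᵇ r) T)

-- The i-pairing.
-- A state P is the list of cells (of rows i, i+1) already paired.

initPaired : ℕ → Diagram → List Cell
initPaired i T =
  filterᵇ (λ x → ((rowOf x ≡ᵇ i) ∧ ((col x , suc i) ∈ᵇ T))
               ∨ ((rowOf x ≡ᵇ suc i) ∧ ((col x , i) ∈ᵇ T))) T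

eligible : ℕ → Diagram → List Cell → ℕ × ℕ → Bool
eligible i T P (a , b) =
  (a <ᵇ b) ∧ not ((a , i) ∈ᵇ P) ∧ not ((b , suc i) ∈ᵇ P)
  ∧ all (λ x → not (((rowOf x ≡ᵇ i) ∨ (rowOf x ≡ᵇ suc i))
                    ∧ (a <ᵇ col x) ∧ (col x <ᵇ b))
               ∨ (x ∈ᵇ P)) T

candidates : ℕ → Diagram → List (ℕ × ℕ)
candidates i T = concatMap (λ a → map (λ b → (a , b)) (rowCols (suc i) T)) (rowCols i T)

pairStep : ℕ → Diagram → List Cell → List Cell
pairStep i T P with filterᵇ (eligible i T P) (candidates i T)
... | []            = P
... | (a , b) ∷ _   = (a , i) ∷ (b , suc i) ∷ P

iterate : ℕ → (List Cell → List Cell) → List Cell → List Cell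
iterate zero    f P = P
iterate (suc n) f P = iterate n f (f P)

-- Each effective step pairs a new cell of row i, so |T| iterations suffice
-- to reach the state where no further pairing is possible.
pairedCells : ℕ → Diagram → List Cell
pairedCells i T = iterate (length T) (pairStep i T) (initPaired i T)

IPaired : ℕ → Diagram → Cell → Set
IPaired i T x = x ∈ T × x ∈ pairedCells i T

maxMaybe : List ℕ → Maybe ℕ
maxMaybe [] = nothing
maxMaybe (x ∷ xs) with maxMaybe xs
... | nothing = just x
... | just m  = just (if x <ᵇ m then m else x)

raiseCol : ℕ → Diagram → Maybe ℕ
raiseCol i T =
  maxMaybe (filterᵇ (λ b → not ((b , suc i) ∈ᵇ pairedCells i T)) (rowCols (suc i) T))

moveDown : ℕ → ℕ → Diagram → Diagram
moveDown i c T = map (λ x → if eqCellᵇ x (c , suc i) then (c , i) else x) T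

-- 𝔢 i T = nothing encodes 𝔢_i(T) = 0.
𝔢 : ℕ → Diagram → Maybe Diagram
𝔢 i T with raiseCol i T
... | nothing = nothing
... | just c  = just (moveDown i c T)

module Submission where

-- Call a column an opener if T has a cell in row i but not in row i+1
-- there, a closer in the opposite case, and let the height H(y) be the
-- number of openers minus the number of closers among the columns < y.
-- The i-pairing matches openers "(" with closers ")" like brackets, so it
-- is determined by H (columns with cells in both rows are always paired):
--   an opener a is unpaired  iff  H(a) < H(y) for every y > a,
--   a closer  b is unpaired  iff  H(b+1) < H(y) for every y ≤ b.  Raising the rightmost unpaired
-- closer c makes it an opener and adds 2 to H(y) exactly for y > c; Raising
-- compares the characterisations in T and 𝔢_i(T) column by column.

open import Defs
open import Data.Nat using (ℕ; suc; _≤_)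
open import Data.Product using (_×_; _,_)
open import Data.Sum using (_⊎_)
open import Data.Maybe using (just)
open import Data.List.Membership.Propositional using (_∈_)
open import Relation.Binary.PropositionalEquality using (_≡_)
open import Relation.Nullary using (¬_)
open import Function.Bundles using (_⇔_; mk⇔; Equivalence)
import Function.Properties.Equivalence as ⇔

open import Data.Nat using (zero; _<_; z≤n; s≤s; _<ᵇ_; _≡ᵇ_; _+_; _∸_)
import Data.Nat.Properties as ℕₚ
open import Data.Nat.Induction using (<-rec)
open import Data.Integer as ℤ using (ℤ; 0ℤ; 1ℤ; -1ℤ)
import Data.Integer.Properties as ℤₚ
open import Data.Integer.Tactic.RingSolver using (solve-∀)
open import Data.Bool using (Bool; true; false; _∧_; _∨_; not; if_then_else_; T)
open import Data.Unit using (tt)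
open import Data.Empty using (⊥; ⊥-elim)
open import Data.Product using (Σ; proj₁; proj₂)
open import Data.Sum using (inj₁; inj₂)
open import Data.List using (List; []; _∷_; map; filterᵇ; length; concatMap)
open import Data.Bool.ListAction using (all)
open import Data.List.Relation.Unary.Any using (here; there)
open import Data.Maybe using (nothing)
open import Relation.Binary.PropositionalEquality
  using (refl; sym; trans; cong; cong₂; subst; subst₂; _≢_; module ≡-Reasoning)
open import Relation.Nullary using (yes; no)
import Data.List.Membership.Propositional.Properties as ∈ₚ
open import Relation.Binary.Definitions using (tri<; tri≈; tri>)

∧-true-l : ∀ {a b} → a ∧ b ≡ true → a ≡ true
∧-true-l {true} _ = refl

∧-true-r : ∀ {a b} → a ∧ b ≡ true → b ≡ true
∧-true-r {true} p = p

∨-true : ∀ {a b} → a ∨ b ≡ true → a ≡ true ⊎ b ≡ true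
∨-true {true}  _ = inj₁ refl
∨-true {false} p = inj₂ p

∨-false : ∀ {a b} → a ∨ b ≡ false → a ≡ false × b ≡ false
∨-false {false} p = refl , p

∨-true-r : ∀ a → a ∨ true ≡ true
∨-true-r true  = refl
∨-true-r false = refl

not-true : ∀ {a} → not a ≡ true → a ≡ false
not-true {false} _ = refl

not-false : ∀ {a} → not a ≡ false → a ≡ true
not-false {true} _ = refl

false⇒not-true : ∀ {a} → a ≡ false → not a ≡ true
false⇒not-true refl = refl

true-or-false : ∀ b → b ≡ true ⊎ b ≡ false
true-or-false true  = inj₁ refl
true-or-false false = inj₂ refl

true≢false : ∀ {a} → a ≡ true → a ≡ false → ⊥
true≢false refl ()

false-equivalent : ∀ {a b : Bool} → (a ≡ false ⇔ b ≡ false) → a ≡ b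
false-equivalent {true}  {true}  _ = refl
false-equivalent {true}  {false} e with Equivalence.from e refl
... | ()
false-equivalent {false} {true}  e with Equivalence.to e refl
... | ()
false-equivalent {false} {false} _ = refl

≡ᵇ⇒≡ : ∀ m n → (m ≡ᵇ n) ≡ true → m ≡ n
≡ᵇ⇒≡ m n p = ℕₚ.≡ᵇ⇒≡ m n (subst T (sym p) tt)

≡ᵇ-refl : ∀ m → (m ≡ᵇ m) ≡ true
≡ᵇ-refl zero    = refl
≡ᵇ-refl (suc m) = ≡ᵇ-refl m

≢⇒≡ᵇ-false : ∀ m n → m ≢ n → (m ≡ᵇ n) ≡ false
≢⇒≡ᵇ-false zero    zero    m≢n = ⊥-elim (m≢n refl)
≢⇒≡ᵇ-false zero    (suc n) _   = refl
≢⇒≡ᵇ-false (suc m) zero    _   = refl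
≢⇒≡ᵇ-false (suc m) (suc n) m≢n = ≢⇒≡ᵇ-false m n (λ e → m≢n (cong suc e))

<ᵇ⇒< : ∀ m n → (m <ᵇ n) ≡ true → m < n
<ᵇ⇒< m n p = ℕₚ.<ᵇ⇒< m n (subst T (sym p) tt)

<⇒<ᵇ : ∀ m n → m < n → (m <ᵇ n) ≡ true
<⇒<ᵇ zero    (suc n) _         = refl
<⇒<ᵇ (suc m) (suc n) (s≤s m<n) = <⇒<ᵇ m n m<n

suc≢ : ∀ n → suc n ≢ n
suc≢ n ()

eqCell⇒≡ : ∀ x y → eqCellᵇ x y ≡ true → x ≡ y
eqCell⇒≡ (a , b) (c , d) p
  with ≡ᵇ⇒≡ a c (∧-true-l p) | ≡ᵇ⇒≡ b d (∧-true-r {a ≡ᵇ c} p)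
... | refl | refl = refl

eqCell-refl : ∀ x → eqCellᵇ x x ≡ true
eqCell-refl (a , b) rewrite ≡ᵇ-refl a | ≡ᵇ-refl b = refl

eqCell-col≢ : ∀ a b r s → a ≢ b → eqCellᵇ (a , r) (b , s) ≡ false
eqCell-col≢ a b r s a≢b rewrite ≢⇒≡ᵇ-false a b a≢b = refl

eqCell-row≢ : ∀ a b r s → r ≢ s → eqCellᵇ (a , r) (b , s) ≡ false
eqCell-row≢ a b r s r≢s rewrite ≢⇒≡ᵇ-false r s r≢s with a ≡ᵇ b
... | true  = refl
... | false = refl

eqCell-sym-false : ∀ x y → eqCellᵇ x y ≡ false → eqCellᵇ y x ≡ false
eqCell-sym-false x y p with eqCellᵇ y x in q
... | false = refl
... | true with eqCell⇒≡ y x q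
... | refl = ⊥-elim (true≢false (eqCell-refl y) p)

∈ᵇ⇒∈ : ∀ x L → x ∈ᵇ L ≡ true → x ∈ L
∈ᵇ⇒∈ x (y ∷ L) p with ∨-true {eqCellᵇ x y} p
... | inj₁ q = here (eqCell⇒≡ x y q)
... | inj₂ q = there (∈ᵇ⇒∈ x L q)

∈⇒∈ᵇ : ∀ x L → x ∈ L → x ∈ᵇ L ≡ true
∈⇒∈ᵇ x (y ∷ L) (here refl) rewrite eqCell-refl x = refl
∈⇒∈ᵇ x (y ∷ L) (there p) rewrite ∈⇒∈ᵇ x L p = ∨-true-r (eqCellᵇ x y)

∈ᵇ-false⇒∉ : ∀ x L → x ∈ᵇ L ≡ false → ¬ (x ∈ L)
∈ᵇ-false⇒∉ x L p q = true≢false (∈⇒∈ᵇ x L q) p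

∈ᵇ-cases : ∀ x L → x ∈ᵇ L ≡ true ⊎ x ∈ᵇ L ≡ false
∈ᵇ-cases x L = true-or-false (x ∈ᵇ L)

∈-filterᵇ⁻ : ∀ {A : Set} (p : A → Bool) L x → x ∈ filterᵇ p L → x ∈ L × p x ≡ true
∈-filterᵇ⁻ p (y ∷ L) x m with p y in py
∈-filterᵇ⁻ p (y ∷ L) x (here refl) | true = here refl , py
∈-filterᵇ⁻ p (y ∷ L) x (there m)   | true with ∈-filterᵇ⁻ p L x m
... | x∈L , px = there x∈L , px
∈-filterᵇ⁻ p (y ∷ L) x m | false with ∈-filterᵇ⁻ p L x m
... | x∈L , px = there x∈L , px

∈-filterᵇ⁺ : ∀ {A : Set} (p : A → Bool) L x → x ∈ L → p x ≡ true → x ∈ filterᵇ p L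
∈-filterᵇ⁺ p (y ∷ L) x (here refl) px rewrite px = here refl
∈-filterᵇ⁺ p (y ∷ L) x (there m) px with p y
... | true  = there (∈-filterᵇ⁺ p L x m px)
... | false = ∈-filterᵇ⁺ p L x m px

∈-all : ∀ {A : Set} (p : A → Bool) L x → all p L ≡ true → x ∈ L → p x ≡ true
∈-all p (y ∷ L) x q (here refl) = ∧-true-l q
∈-all p (y ∷ L) x q (there m)   = ∈-all p L x (∧-true-r {p y} q) m

all-false : ∀ {A : Set} (p : A → Bool) L → all p L ≡ false → Σ A (λ x → x ∈ L × p x ≡ false)
all-false p (y ∷ L) q with p y in py
... | false = y , here refl , py
... | true with all-false p L q
... | x , x∈L , px = x , there x∈L , px

rowCols⁻ : ∀ r T b → b ∈ rowCols r T → (b , r) ∈ T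
rowCols⁻ r T b m with ∈ₚ.∈-map⁻ col m
... | (x , y) , xy∈ , refl with ∈-filterᵇ⁻ (λ x → rowOf x ≡ᵇ r) T (x , y) xy∈
... | xy∈T , y≡r with ≡ᵇ⇒≡ y r y≡r
... | refl = xy∈T

rowCols⁺ : ∀ r T b → (b , r) ∈ T → b ∈ rowCols r T
rowCols⁺ r T b m = ∈ₚ.∈-map⁺ col (∈-filterᵇ⁺ (λ x → rowOf x ≡ᵇ r) T (b , r) m (≡ᵇ-refl r))

pairs⁻ : ∀ (A B : List ℕ) a b → (a , b) ∈ concatMap (λ a → map (λ b → (a , b)) B) A →
         a ∈ A × b ∈ B
pairs⁻ (x ∷ A) B a b m with ∈ₚ.∈-++⁻ (map (λ b → (x , b)) B) m
... | inj₁ m₁ with ∈ₚ.∈-map⁻ (λ b → (x , b)) m₁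
... | _ , b∈B , refl = here refl , b∈B
pairs⁻ (x ∷ A) B a b m | inj₂ m₂ with pairs⁻ A B a b m₂
... | a∈A , b∈B = there a∈A , b∈B

pairs⁺ : ∀ (A B : List ℕ) a b → a ∈ A → b ∈ B →
         (a , b) ∈ concatMap (λ a → map (λ b → (a , b)) B) A
pairs⁺ (x ∷ A) B a b (here refl) b∈B = ∈ₚ.∈-++⁺ˡ (∈ₚ.∈-map⁺ (λ b → (a , b)) b∈B)
pairs⁺ (x ∷ A) B a b (there a∈A) b∈B =
  ∈ₚ.∈-++⁺ʳ (map (λ b → (x , b)) B) (pairs⁺ A B a b a∈A b∈B)

count : {A : Set} → (A → Bool) → List A → ℕ
count p []      = 0
count p (x ∷ L) = if p x then suc (count p L) else count p L

count-mono : ∀ {A : Set} (p q : A → Bool) L → (∀ x → q x ≡ true → p x ≡ true) → count q L ≤ count p L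
count-mono p q []      _   = z≤n
count-mono p q (x ∷ L) q⊆p with q x in qx
... | true rewrite q⊆p x qx = s≤s (count-mono p q L q⊆p)
... | false with p x
... | true  = ℕₚ.m≤n⇒m≤1+n (count-mono p q L q⊆p)
... | false = count-mono p q L q⊆p

count-strict : ∀ {A : Set} (p q : A → Bool) L x → (∀ y → q y ≡ true → p y ≡ true) → x ∈ L →
               p x ≡ true → q x ≡ false → count q L < count p L
count-strict p q (y ∷ L) x q⊆p (here refl) px qx rewrite px | qx = s≤s (count-mono p q L q⊆p)
count-strict p q (y ∷ L) x q⊆p (there x∈L) px qx with q y in qy
... | true rewrite q⊆p y qy = s≤s (count-strict p q L x q⊆p x∈L px qx)
... | false with p y
... | true  = ℕₚ.m≤n⇒m≤1+n (count-strict p q L x q⊆p x∈L px qx)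
... | false = count-strict p q L x q⊆p x∈L px qx

count-≤-length : ∀ {A : Set} (p : A → Bool) L → count p L ≤ length L
count-≤-length p []      = z≤n
count-≤-length p (x ∷ L) with p x
... | true  = s≤s (count-≤-length p L)
... | false = ℕₚ.m≤n⇒m≤1+n (count-≤-length p L)

iterate-fixed : ∀ n (f : List Cell → List Cell) P → f P ≡ P → iterate n f P ≡ P
iterate-fixed zero    f P _     = refl
iterate-fixed (suc n) f P fP≡P rewrite fP≡P = iterate-fixed n f P fP≡P

psum : (ℕ → ℤ) → ℕ → ℤ
psum f zero    = 0ℤ
psum f (suc n) = psum f n ℤ.+ f n

psum-+ : ∀ f g h → (∀ x → f x ≡ g x ℤ.+ h x) → ∀ y → psum f y ≡ psum g y ℤ.+ psum h y
psum-+ f g h f≡g+h zero = refl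
psum-+ f g h f≡g+h (suc y) rewrite psum-+ f g h f≡g+h y | f≡g+h y = interchange (psum g y) (psum h y) (g y) (h y)
  where
  interchange : ∀ (a b c d : ℤ) → (a ℤ.+ b) ℤ.+ (c ℤ.+ d) ≡ (a ℤ.+ c) ℤ.+ (b ℤ.+ d)
  interchange = solve-∀

psum-zero : ∀ f → (∀ x → f x ≡ 0ℤ) → ∀ y → psum f y ≡ 0ℤ
psum-zero f f≡0 zero    = refl
psum-zero f f≡0 (suc y) rewrite psum-zero f f≡0 y | f≡0 y = refl

psum-increasing : ∀ f m y → m ≤ y → (∀ x → m ≤ x → x < y → 0ℤ ℤ.≤ f x) →
                  psum f m ℤ.≤ psum f y
psum-increasing f m zero    z≤n _ = ℤₚ.≤-refl
psum-increasing f m (suc y) m≤1+y f≥0 with ℕₚ.m≤n⇒m<n∨m≡n m≤1+y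
... | inj₂ refl = ℤₚ.≤-refl
... | inj₁ m<1+y = ℤₚ.≤-trans
        (psum-increasing f m y m≤y (λ x m≤x x<y → f≥0 x m≤x (ℕₚ.m≤n⇒m≤1+n x<y)))
        (ℤₚ.≤-trans (ℤₚ.≤-reflexive (sym (ℤₚ.+-identityʳ (psum f y))))
          (ℤₚ.+-monoʳ-≤ (psum f y) (f≥0 y m≤y ℕₚ.≤-refl)))
    where
    m≤y : m ≤ y
    m≤y = ℕₚ.≤-pred m<1+y

psum-decreasing : ∀ f m y → m ≤ y → (∀ x → m ≤ x → x < y → f x ℤ.≤ 0ℤ) →
                  psum f y ℤ.≤ psum f m
psum-decreasing f m zero    z≤n _ = ℤₚ.≤-refl
psum-decreasing f m (suc y) m≤1+y f≤0 with ℕₚ.m≤n⇒m<n∨m≡n m≤1+y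
... | inj₂ refl = ℤₚ.≤-refl
... | inj₁ m<1+y = ℤₚ.≤-trans
        (ℤₚ.+-monoʳ-≤ (psum f y) (f≤0 y m≤y ℕₚ.≤-refl))
        (ℤₚ.≤-trans (ℤₚ.≤-reflexive (ℤₚ.+-identityʳ (psum f y)))
          (psum-decreasing f m y m≤y (λ x m≤x x<y → f≤0 x m≤x (ℕₚ.m≤n⇒m≤1+n x<y))))
    where
    m≤y : m ≤ y
    m≤y = ℕₚ.≤-pred m<1+y

i<i+1 : ∀ z → z ℤ.< z ℤ.+ 1ℤ
i<i+1 z = subst (λ u → u ℤ.< z ℤ.+ 1ℤ) (ℤₚ.+-identityʳ z) (ℤₚ.+-monoʳ-< z (ℤ.+<+ (s≤s z≤n)))

i-1<i : ∀ z → z ℤ.+ -1ℤ ℤ.< z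
i-1<i z = subst (λ u → z ℤ.+ -1ℤ ℤ.< u) (ℤₚ.+-identityʳ z) (ℤₚ.+-monoʳ-< z ℤ.-<+)

+-cancelʳ-< : ∀ k {a b} → a ℤ.+ k ℤ.< b ℤ.+ k → a ℤ.< b
+-cancelʳ-< k {a} {b} p = subst₂ ℤ._<_ (cancel a k) (cancel b k) (ℤₚ.+-monoˡ-< (ℤ.- k) p)
  where
  cancel : ∀ u k → (u ℤ.+ k) ℤ.+ ℤ.- k ≡ u
  cancel = solve-∀

+-<⇔ : ∀ k a b → (a ℤ.< b ⇔ a ℤ.+ k ℤ.< b ℤ.+ k)
+-<⇔ k a b = mk⇔ (ℤₚ.+-monoˡ-< k) (+-cancelʳ-< k)

<⇒+1≤ : ∀ {a b} → a ℤ.< b → a ℤ.+ 1ℤ ℤ.≤ b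
<⇒+1≤ {a} p = subst (λ u → u ℤ.≤ _) (ℤₚ.+-comm 1ℤ a) (ℤₚ.i<j⇒suc[i]≤j p)

pulse : ℕ → ℤ → ℕ → ℤ
pulse c k x = if x ≡ᵇ c then k else 0ℤ

pulse-at : ∀ c k → pulse c k c ≡ k
pulse-at c k rewrite ≡ᵇ-refl c = refl

pulse-off : ∀ c k x → x ≢ c → pulse c k x ≡ 0ℤ
pulse-off c k x x≢c rewrite ≢⇒≡ᵇ-false x c x≢c = refl

psum-pulse-before : ∀ c k y → y ≤ c → psum (pulse c k) y ≡ 0ℤ
psum-pulse-before c k zero    _     = refl
psum-pulse-before c k (suc y) 1+y≤c
  rewrite psum-pulse-before c k y (ℕₚ.<⇒≤ 1+y≤c)
        | pulse-off c k y (ℕₚ.<⇒≢ 1+y≤c) = refl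

psum-pulse-after : ∀ c k y → c < y → psum (pulse c k) y ≡ k
psum-pulse-after c k (suc y) c<1+y with ℕₚ.m≤n⇒m<n∨m≡n (ℕₚ.≤-pred c<1+y)
... | inj₁ c<y rewrite psum-pulse-after c k y c<y
                     | pulse-off c k y (λ y≡c → ℕₚ.<⇒≢ c<y (sym y≡c)) = ℤₚ.+-identityʳ k
... | inj₂ refl rewrite psum-pulse-before c k c ℕₚ.≤-refl | pulse-at c k = ℤₚ.+-identityˡ k

bound : Diagram → ℕ
bound []      = 0
bound (x ∷ T) = suc (col x) + bound T

bound-> : ∀ T x r → (x , r) ∈ T → x < bound T
bound-> (y ∷ T) x r (here refl) = s≤s (ℕₚ.m≤m+n x (bound T))
bound-> (y ∷ T) x r (there m)   =
  ℕₚ.<-≤-trans (bound-> T x r m) (ℕₚ.m≤n+m (bound T) (suc (col y)))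

maxMaybe-nothing : ∀ L → maxMaybe L ≡ nothing → L ≡ []
maxMaybe-nothing []      _ = refl
maxMaybe-nothing (x ∷ L) e with maxMaybe L
maxMaybe-nothing (x ∷ L) () | nothing
maxMaybe-nothing (x ∷ L) () | just _

maxMaybe-max : ∀ L m → maxMaybe L ≡ just m → m ∈ L × (∀ x → x ∈ L → x ≤ m)
maxMaybe-max (x ∷ L) m e with maxMaybe L in eq
maxMaybe-max (x ∷ L) m refl | nothing = here refl , below
  where
  below : ∀ y → y ∈ x ∷ L → y ≤ x
  below y (here refl) = ℕₚ.≤-refl
  below y (there y∈L) with maxMaybe-nothing L eq
  below y (there ()) | refl
maxMaybe-max (x ∷ L) m refl | just m′ with maxMaybe-max L m′ eq
... | m′∈L , m′-max with x <ᵇ m′ in x<m′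
... | true = there m′∈L , below
  where
  below : ∀ y → y ∈ x ∷ L → y ≤ m′
  below y (here refl) = ℕₚ.<⇒≤ (<ᵇ⇒< x m′ x<m′)
  below y (there y∈L) = m′-max y y∈L
... | false = here refl , below
  where
  below : ∀ y → y ∈ x ∷ L → y ≤ x
  below y (here refl) = ℕₚ.≤-refl
  below y (there y∈L) =
    ℕₚ.≤-trans (m′-max y y∈L) (ℕₚ.≮⇒≥ (λ x<m′′ → true≢false (<⇒<ᵇ x m′ x<m′′) x<m′))

-- For a column, o / c say whether it is an opener / a
-- closer, and m / n whether its cell in row i / row i+1 is already paired.

weight : Bool → Bool → ℤ
weight true  _     = 1ℤ
weight false true  = -1ℤ
weight false false = 0ℤ

pairedWeight : Bool → Bool → Bool → Bool → ℤ
pairedWeight true  _     true  _     = 1ℤ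
pairedWeight true  _     false _     = 0ℤ
pairedWeight false true  _     true  = -1ℤ
pairedWeight false true  _     false = 0ℤ
pairedWeight false false _     _     = 0ℤ

freeWeight : Bool → Bool → Bool → Bool → ℤ
freeWeight true  _     true  _     = 0ℤ
freeWeight true  _     false _     = 1ℤ
freeWeight false true  _     true  = 0ℤ
freeWeight false true  _     false = -1ℤ
freeWeight false false _     _     = 0ℤ

weight-split : ∀ o c m n → weight o c ≡ pairedWeight o c m n ℤ.+ freeWeight o c m n
weight-split true  c     true  n     = refl
weight-split true  c     false n     = refl
weight-split false true  m     true  = refl
weight-split false true  m     false = refl
weight-split false false m     n     = refl

pairedWeight-vanishes : ∀ o c m n → (m ≡ true → o ≡ false) → (n ≡ true → c ≡ false) →
                        pairedWeight o c m n ≡ 0ℤ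
pairedWeight-vanishes true  c     true  n     m⇒¬o _ with m⇒¬o refl
... | ()
pairedWeight-vanishes true  c     false n     _ _ = refl
pairedWeight-vanishes false true  m     true  _ n⇒¬c with n⇒¬c refl
... | ()
pairedWeight-vanishes false true  m     false _ _ = refl
pairedWeight-vanishes false false m     n     _ _ = refl

module Heights (i : ℕ) where

  occ : Diagram → ℕ → ℕ → Bool
  occ T x r = (x , r) ∈ᵇ T

  opener : Diagram → ℕ → Bool
  opener T x = occ T x i ∧ not (occ T x (suc i))

  closer : Diagram → ℕ → Bool
  closer T x = occ T x (suc i) ∧ not (occ T x i)

  opener-intro : ∀ T x → occ T x i ≡ true → occ T x (suc i) ≡ false → opener T x ≡ true
  opener-intro T x p q rewrite p | q = refl

  closer-intro : ∀ T x → occ T x (suc i) ≡ true → occ T x i ≡ false → closer T x ≡ true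
  closer-intro T x p q rewrite p | q = refl

  opener-upper : ∀ T x → occ T x (suc i) ≡ true → opener T x ≡ false
  opener-upper T x p rewrite p with occ T x i
  ... | true  = refl
  ... | false = refl

  closer-lower : ∀ T x → occ T x i ≡ true → closer T x ≡ false
  closer-lower T x p rewrite p with occ T x (suc i)
  ... | true  = refl
  ... | false = refl

  w : Diagram → ℕ → ℤ
  w T x = weight (opener T x) (closer T x)

  wPaired : Diagram → List Cell → ℕ → ℤ
  wPaired T P x = pairedWeight (opener T x) (closer T x) ((x , i) ∈ᵇ P) ((x , suc i) ∈ᵇ P)

  wFree : Diagram → List Cell → ℕ → ℤ
  wFree T P x = freeWeight (opener T x) (closer T x) ((x , i) ∈ᵇ P) ((x , suc i) ∈ᵇ P)

  H : Diagram → ℕ → ℤ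
  H T = psum (w T)

  HPaired : Diagram → List Cell → ℕ → ℤ
  HPaired T P = psum (wPaired T P)

  HFree : Diagram → List Cell → ℕ → ℤ
  HFree T P = psum (wFree T P)

  H-split : ∀ T P y → H T y ≡ HPaired T P y ℤ.+ HFree T P y
  H-split T P = psum-+ (w T) (wPaired T P) (wFree T P) (λ x → weight-split _ _ _ _)

  w-at : ∀ T x {o c} → opener T x ≡ o → closer T x ≡ c → w T x ≡ weight o c
  w-at T x refl refl = refl

  wPaired-at : ∀ T P x {o c m n} → opener T x ≡ o → closer T x ≡ c →
               (x , i) ∈ᵇ P ≡ m → (x , suc i) ∈ᵇ P ≡ n → wPaired T P x ≡ pairedWeight o c m n
  wPaired-at T P x refl refl refl refl = refl

  wFree-at : ∀ T P x {o c m n} → opener T x ≡ o → closer T x ≡ c →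
             (x , i) ∈ᵇ P ≡ m → (x , suc i) ∈ᵇ P ≡ n → wFree T P x ≡ freeWeight o c m n
  wFree-at T P x refl refl refl refl = refl

  H-step-up : ∀ T x → closer T x ≡ false → H T x ℤ.≤ H T (suc x)
  H-step-up T x not-closer rewrite w-at T x refl not-closer with opener T x
  ... | true  = ℤₚ.<⇒≤ (i<i+1 (H T x))
  ... | false = ℤₚ.≤-reflexive (sym (ℤₚ.+-identityʳ (H T x)))

  -- The invariant of the pairing iteration: the paired cells form a
  -- balanced bracket word (paired height ≥ 0, back to 0 beyond the last
  -- column), which sits at level 0 at every free opener and free closer,
  -- and every column with cells in both rows is paired.
  record Invariant (T : Diagram) (P : List Cell) : Set where
    field
      paired-nonneg : ∀ y → 0ℤ ℤ.≤ HPaired T P y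
      level-at-free-opener : ∀ z → opener T z ≡ true → (z , i) ∈ᵇ P ≡ false →
                             HPaired T P z ≡ 0ℤ
      level-at-free-closer : ∀ z → closer T z ≡ true → (z , suc i) ∈ᵇ P ≡ false →
                             HPaired T P z ≡ 0ℤ
      level-at-bound : HPaired T P (bound T) ≡ 0ℤ
      vertical-paired : ∀ x → occ T x i ≡ true → occ T x (suc i) ≡ true →
                        (x , i) ∈ᵇ P ≡ true × (x , suc i) ∈ᵇ P ≡ true

  Saturated : Diagram → List Cell → Set
  Saturated T P = filterᵇ (eligible i T P) (candidates i T) ≡ []

  initPaired-vertical : ∀ T x r → (x , r) ∈ᵇ initPaired i T ≡ true →
                        occ T x i ≡ true × occ T x (suc i) ≡ true
  initPaired-vertical T x r p with ∈-filterᵇ⁻ _ T (x , r) (∈ᵇ⇒∈ _ _ p)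
  ... | x∈T , q with ∨-true {(r ≡ᵇ i) ∧ ((x , suc i) ∈ᵇ T)} q
  ... | inj₁ q₁ with ≡ᵇ⇒≡ r i (∧-true-l q₁)
  ... | refl = ∈⇒∈ᵇ _ _ x∈T , ∧-true-r {r ≡ᵇ i} q₁
  initPaired-vertical T x r p | x∈T , q | inj₂ q₂ with ≡ᵇ⇒≡ r (suc i) (∧-true-l q₂)
  ... | refl = ∧-true-r {r ≡ᵇ suc i} q₂ , ∈⇒∈ᵇ _ _ x∈T

  vertical-initPaired : ∀ T x → occ T x i ≡ true → occ T x (suc i) ≡ true →
                        (x , i) ∈ᵇ initPaired i T ≡ true × (x , suc i) ∈ᵇ initPaired i T ≡ true
  vertical-initPaired T x lower upper =
      ∈⇒∈ᵇ _ _ (∈-filterᵇ⁺ _ T (x , i) (∈ᵇ⇒∈ _ _ lower) lower-test)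
    , ∈⇒∈ᵇ _ _ (∈-filterᵇ⁺ _ T (x , suc i) (∈ᵇ⇒∈ _ _ upper) upper-test)
    where
    lower-test : (((i ≡ᵇ i) ∧ ((x , suc i) ∈ᵇ T)) ∨ ((i ≡ᵇ suc i) ∧ ((x , i) ∈ᵇ T))) ≡ true
    lower-test rewrite ≡ᵇ-refl i | upper = refl
    upper-test : (((suc i ≡ᵇ i) ∧ ((x , suc i) ∈ᵇ T)) ∨ ((suc i ≡ᵇ suc i) ∧ ((x , i) ∈ᵇ T))) ≡ true
    upper-test rewrite ≢⇒≡ᵇ-false (suc i) i (suc≢ i) | ≡ᵇ-refl i | lower = refl

  initPaired-invariant : ∀ T → Invariant T (initPaired i T)
  initPaired-invariant T = record
    { paired-nonneg        = λ y → ℤₚ.≤-reflexive (sym (level-zero y))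
    ; level-at-free-opener = λ z _ _ → level-zero z
    ; level-at-free-closer = λ z _ _ → level-zero z
    ; level-at-bound       = level-zero (bound T)
    ; vertical-paired      = vertical-initPaired T }
    where
    level-zero : ∀ y → HPaired T (initPaired i T) y ≡ 0ℤ
    level-zero = psum-zero _ λ x → pairedWeight-vanishes _ _ _ _
      (λ m → opener-upper T x (proj₂ (initPaired-vertical T x i m)))
      (λ n → closer-lower T x (proj₁ (initPaired-vertical T x (suc i) n)))

  module Step (T : Diagram) (P : List Cell) (a b : ℕ) where

    P′ : List Cell
    P′ = (a , i) ∷ (b , suc i) ∷ P

    P′-other : ∀ x r → x ≢ a → x ≢ b → (x , r) ∈ᵇ P′ ≡ (x , r) ∈ᵇ P
    P′-other x r x≢a x≢b rewrite eqCell-col≢ x a r i x≢a | eqCell-col≢ x b r (suc i) x≢b = refl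

    P⊆P′ : ∀ x → x ∈ᵇ P ≡ true → x ∈ᵇ P′ ≡ true
    P⊆P′ x p rewrite p | ∨-true-r (eqCellᵇ x (b , suc i)) = ∨-true-r (eqCellᵇ x (a , i))

    P′-free⇒P-free : ∀ x → x ∈ᵇ P′ ≡ false → x ∈ᵇ P ≡ false
    P′-free⇒P-free x p with ∈ᵇ-cases x P
    ... | inj₂ q = q
    ... | inj₁ q = ⊥-elim (true≢false (P⊆P′ x q) p)

    a∈P′ : (a , i) ∈ᵇ P′ ≡ true
    a∈P′ rewrite eqCell-refl (a , i) = refl

    b∈P′ : (b , suc i) ∈ᵇ P′ ≡ true
    b∈P′ rewrite eqCell-row≢ b a (suc i) i (suc≢ i) | eqCell-refl (b , suc i) = refl

    -- Pairing a with b raises the paired height by 1 exactly on (a , b].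
    bump : ℕ → ℤ
    bump x = pulse a 1ℤ x ℤ.+ pulse b -1ℤ x

    betweenPairedᵇ : Bool
    betweenPairedᵇ =
      all (λ x → not (((rowOf x ≡ᵇ i) ∨ (rowOf x ≡ᵇ suc i)) ∧ (a <ᵇ col x) ∧ (col x <ᵇ b))
                 ∨ (x ∈ᵇ P)) T

    BetweenPaired : Set
    BetweenPaired = betweenPairedᵇ ≡ true

    eligible⁻ : eligible i T P (a , b) ≡ true →
                a < b × (a , i) ∈ᵇ P ≡ false × (b , suc i) ∈ᵇ P ≡ false × BetweenPaired
    eligible⁻ e = <ᵇ⇒< a b (∧-true-l e) , not-true (∧-true-l e₁) , not-true (∧-true-l e₂)
                , ∧-true-r {not ((b , suc i) ∈ᵇ P)} e₂
      where
      e₁ : (not ((a , i) ∈ᵇ P) ∧ not ((b , suc i) ∈ᵇ P) ∧ betweenPairedᵇ) ≡ true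
      e₁ = ∧-true-r {a <ᵇ b} e
      e₂ : (not ((b , suc i) ∈ᵇ P) ∧ betweenPairedᵇ) ≡ true
      e₂ = ∧-true-r {not ((a , i) ∈ᵇ P)} e₁

    ineligible⁻ : a < b → (a , i) ∈ᵇ P ≡ false → (b , suc i) ∈ᵇ P ≡ false →
                  eligible i T P (a , b) ≡ false → betweenPairedᵇ ≡ false
    ineligible⁻ a<b a-free b-free e rewrite <⇒<ᵇ a b a<b | a-free | b-free = e

    module _ (a<b : a < b) where

      psum-bump-outside : ∀ y → y ≤ a ⊎ b < y → psum bump y ≡ 0ℤ
      psum-bump-outside y side rewrite psum-+ bump (pulse a 1ℤ) (pulse b -1ℤ) (λ _ → refl) y
        with side
      ... | inj₁ y≤a rewrite psum-pulse-before a 1ℤ y y≤a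
                           | psum-pulse-before b -1ℤ y (ℕₚ.≤-trans y≤a (ℕₚ.<⇒≤ a<b)) = refl
      ... | inj₂ b<y rewrite psum-pulse-after a 1ℤ y (ℕₚ.<-trans a<b b<y)
                           | psum-pulse-after b -1ℤ y b<y = refl

      psum-bump-nonneg : ∀ y → 0ℤ ℤ.≤ psum bump y
      psum-bump-nonneg y with ℕₚ.≤-<-connex y a | ℕₚ.≤-<-connex y b
      ... | inj₁ y≤a | _ = ℤₚ.≤-reflexive (sym (psum-bump-outside y (inj₁ y≤a)))
      ... | inj₂ _   | inj₂ b<y = ℤₚ.≤-reflexive (sym (psum-bump-outside y (inj₂ b<y)))
      ... | inj₂ a<y | inj₁ y≤b
        rewrite psum-+ bump (pulse a 1ℤ) (pulse b -1ℤ) (λ _ → refl) y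
              | psum-pulse-after a 1ℤ y a<y | psum-pulse-before b -1ℤ y y≤b = ℤ.+≤+ z≤n

      module _ (a-opener : opener T a ≡ true) (b-closer : closer T b ≡ true)
               (a-free : (a , i) ∈ᵇ P ≡ false) (b-free : (b , suc i) ∈ᵇ P ≡ false) where

        wPaired-step : ∀ x → wPaired T P′ x ≡ wPaired T P x ℤ.+ bump x
        wPaired-step x with x ℕₚ.≟ a | x ℕₚ.≟ b
        ... | yes refl | _ =
          trans (wPaired-at T P′ a a-opener refl a∈P′ refl)
                (sym (cong₂ ℤ._+_ (wPaired-at T P a a-opener refl a-free refl)
                                  (cong₂ ℤ._+_ (pulse-at a 1ℤ) (pulse-off b -1ℤ a (ℕₚ.<⇒≢ a<b)))))
        ... | no _ | yes refl =
          trans (wPaired-at T P′ b b-opener b-closer refl b∈P′)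
                (sym (cong₂ ℤ._+_ (wPaired-at T P b b-opener b-closer refl b-free)
                                  (cong₂ ℤ._+_ (pulse-off a 1ℤ b (λ e → ℕₚ.<⇒≢ a<b (sym e)))
                                               (pulse-at b -1ℤ))))
          where
          b-opener : opener T b ≡ false
          b-opener = opener-upper T b (∧-true-l b-closer)
        ... | no x≢a | no x≢b =
          trans (wPaired-at T P′ x refl refl (P′-other x i x≢a x≢b) (P′-other x (suc i) x≢a x≢b))
                (sym (trans (cong (λ d → wPaired T P x ℤ.+ d)
                                  (cong₂ ℤ._+_ (pulse-off a 1ℤ x x≢a) (pulse-off b -1ℤ x x≢b)))
                            (ℤₚ.+-identityʳ _)))

        HPaired-step : ∀ y → HPaired T P′ y ≡ HPaired T P y ℤ.+ psum bump y
        HPaired-step = psum-+ _ _ _ wPaired-step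

        module _ (inv : Invariant T P) (between : BetweenPaired) (b∈T : (b , suc i) ∈ T) where
          open Invariant inv

          between-paired : ∀ z r → r ≡ i ⊎ r ≡ suc i → (z , r) ∈ T → a < z → z < b →
                           (z , r) ∈ᵇ P ≡ true
          between-paired z r row z∈T a<z z<b with ∈-all _ T (z , r) between z∈T
          ... | test rewrite <⇒<ᵇ a z a<z | <⇒<ᵇ z b z<b with row
          ... | inj₁ refl rewrite ≡ᵇ-refl i = test
          ... | inj₂ refl rewrite ≢⇒≡ᵇ-false (suc i) i (suc≢ i) | ≡ᵇ-refl i = test

          -- A cell free after the step lies outside [a , b], where the bump is 0.
          bump-at-free : ∀ z r → r ≡ i ⊎ r ≡ suc i → (z , r) ∈ T → (z , r) ∈ᵇ P ≡ false →
                         z ≢ a → z ≢ b → psum bump z ≡ 0ℤ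
          bump-at-free z r row z∈T z-free z≢a z≢b with ℕₚ.<-cmp z a
          ... | tri< z<a _ _ = psum-bump-outside z (inj₁ (ℕₚ.<⇒≤ z<a))
          ... | tri≈ _ z≡a _ = ⊥-elim (z≢a z≡a)
          ... | tri> _ _ a<z with ℕₚ.<-cmp z b
          ... | tri< z<b _ _ = ⊥-elim (true≢false (between-paired z r row z∈T a<z z<b) z-free)
          ... | tri≈ _ z≡b _ = ⊥-elim (z≢b z≡b)
          ... | tri> _ _ b<z = psum-bump-outside z (inj₂ b<z)

          level-after : ∀ z → HPaired T P z ≡ 0ℤ → psum bump z ≡ 0ℤ → HPaired T P′ z ≡ 0ℤ
          level-after z p q = trans (HPaired-step z) (cong₂ ℤ._+_ p q)

          opener-level : ∀ z → opener T z ≡ true → (z , i) ∈ᵇ P′ ≡ false → HPaired T P′ z ≡ 0ℤ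
          opener-level z z-opener z-free′ =
            level-after z (level-at-free-opener z z-opener z-free)
              (bump-at-free z i (inj₁ refl) (∈ᵇ⇒∈ _ _ (∧-true-l z-opener)) z-free z≢a z≢b)
            where
            z-free : (z , i) ∈ᵇ P ≡ false
            z-free = P′-free⇒P-free (z , i) z-free′
            z≢a : z ≢ a
            z≢a refl = true≢false a∈P′ z-free′
            z≢b : z ≢ b
            z≢b refl = true≢false z-opener (opener-upper T b (∧-true-l b-closer))

          closer-level : ∀ z → closer T z ≡ true → (z , suc i) ∈ᵇ P′ ≡ false → HPaired T P′ z ≡ 0ℤ
          closer-level z z-closer z-free′ =
            level-after z (level-at-free-closer z z-closer z-free)
              (bump-at-free z (suc i) (inj₂ refl) (∈ᵇ⇒∈ _ _ (∧-true-l z-closer)) z-free z≢a z≢b)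
            where
            z-free : (z , suc i) ∈ᵇ P ≡ false
            z-free = P′-free⇒P-free (z , suc i) z-free′
            z≢a : z ≢ a
            z≢a refl = true≢false a-opener (opener-upper T a (∧-true-l z-closer))
            z≢b : z ≢ b
            z≢b refl = true≢false b∈P′ z-free′

          invariant-step : Invariant T P′
          invariant-step = record
            { paired-nonneg = λ y → ℤₚ.≤-trans (ℤₚ.+-mono-≤ (paired-nonneg y) (psum-bump-nonneg y))
                                                (ℤₚ.≤-reflexive (sym (HPaired-step y)))
            ; level-at-free-opener = opener-level
            ; level-at-free-closer = closer-level
            ; level-at-bound = level-after (bound T) level-at-bound
                                 (psum-bump-outside (bound T) (inj₂ (bound-> T b (suc i) b∈T)))
            ; vertical-paired = λ x lower upper →
                P⊆P′ (x , i) (proj₁ (vertical-paired x lower upper)) ,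
                P⊆P′ (x , suc i) (proj₂ (vertical-paired x lower upper)) }

  data StepView (T : Diagram) (P : List Cell) : Set where
    done  : Saturated T P → pairStep i T P ≡ P → StepView T P
    pairs : ∀ a b → (a , b) ∈ candidates i T → eligible i T P (a , b) ≡ true →
            pairStep i T P ≡ Step.P′ T P a b → StepView T P

  stepView : ∀ T P → StepView T P
  stepView T P with filterᵇ (eligible i T P) (candidates i T) in eq
  ... | [] = done eq (fixed eq)
    where
    fixed : filterᵇ (eligible i T P) (candidates i T) ≡ [] → pairStep i T P ≡ P
    fixed e rewrite e = refl
  ... | (a , b) ∷ rest with ∈-filterᵇ⁻ (eligible i T P) (candidates i T) (a , b)
                             (subst (λ L → (a , b) ∈ L) (sym eq) (here refl))
  ... | ab∈ , ab-eligible = pairs a b ab∈ ab-eligible (first eq)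
    where
    first : filterᵇ (eligible i T P) (candidates i T) ≡ (a , b) ∷ rest →
            pairStep i T P ≡ Step.P′ T P a b
    first e rewrite e = refl

  unpaired : Diagram → List Cell → ℕ
  unpaired T P = count (λ x → not (x ∈ᵇ P)) T

  step-progress : ∀ T P → Invariant T P → ∀ a b → (a , b) ∈ candidates i T →
                  eligible i T P (a , b) ≡ true →
                  Invariant T (Step.P′ T P a b) × unpaired T (Step.P′ T P a b) < unpaired T P
  step-progress T P inv a b ab∈ ab-eligible with Step.eligible⁻ T P a b ab-eligible
  ... | a<b , a-free , b-free , between = invariant′ , fewer-unpaired
    where
    open Step T P a b
    open Invariant inv
    a∈T : (a , i) ∈ T
    a∈T = rowCols⁻ i T a (proj₁ (pairs⁻ (rowCols i T) (rowCols (suc i) T) a b ab∈))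
    b∈T : (b , suc i) ∈ T
    b∈T = rowCols⁻ (suc i) T b (proj₂ (pairs⁻ (rowCols i T) (rowCols (suc i) T) a b ab∈))
    -- a and b are not vertical columns, since those are already paired.
    a-not-upper : occ T a (suc i) ≡ false
    a-not-upper with ∈ᵇ-cases (a , suc i) T
    ... | inj₂ q = q
    ... | inj₁ q = ⊥-elim (true≢false (proj₁ (vertical-paired a (∈⇒∈ᵇ _ _ a∈T) q)) a-free)
    b-not-lower : occ T b i ≡ false
    b-not-lower with ∈ᵇ-cases (b , i) T
    ... | inj₂ q = q
    ... | inj₁ q = ⊥-elim (true≢false (proj₂ (vertical-paired b q (∈⇒∈ᵇ _ _ b∈T))) b-free)
    invariant′ : Invariant T P′
    invariant′ = invariant-step a<b (opener-intro T a (∈⇒∈ᵇ _ _ a∈T) a-not-upper)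
                   (closer-intro T b (∈⇒∈ᵇ _ _ b∈T) b-not-lower) a-free b-free inv between b∈T
    fewer-unpaired : unpaired T P′ < unpaired T P
    fewer-unpaired = count-strict _ _ T (a , i)
      (λ y y-free′ → false⇒not-true (P′-free⇒P-free y (not-true y-free′)))
      a∈T (false⇒not-true a-free) (cong not a∈P′)

  iterate-saturates : ∀ n T P → Invariant T P → unpaired T P ≤ n →
                      Saturated T (iterate n (pairStep i T) P) × Invariant T (iterate n (pairStep i T) P)
  iterate-saturates n T P inv enough with stepView T P
  ... | done saturated fixed rewrite iterate-fixed n (pairStep i T) P fixed = saturated , inv
  ... | pairs a b ab∈ ab-eligible step with step-progress T P inv a b ab∈ ab-eligible
  iterate-saturates zero T P inv enough | pairs _ _ _ _ _ | _ , fewer =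
    ⊥-elim (ℕₚ.n≮0 (ℕₚ.<-≤-trans fewer enough))
  iterate-saturates (suc n) T P inv enough | pairs a b _ _ step | inv′ , fewer
    rewrite step = iterate-saturates n T (Step.P′ T P a b) inv′ (ℕₚ.≤-pred (ℕₚ.<-≤-trans fewer enough))

  pairedCells-final : ∀ T → Saturated T (pairedCells i T) × Invariant T (pairedCells i T)
  pairedCells-final T = iterate-saturates (length T) T (initPaired i T) (initPaired-invariant T)
                          (count-≤-length _ T)

  RisesAfter : Diagram → ℕ → Set
  RisesAfter T a = ∀ y → a < y → H T a ℤ.< H T y

  FallsBefore : Diagram → ℕ → Set
  FallsBefore T b = ∀ y → y ≤ b → H T (suc b) ℤ.< H T y

module FinalPairing (i : ℕ) (T : Diagram) where
  open Heights i

  P : List Cell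
  P = pairedCells i T

  saturated : Saturated T P
  saturated = proj₁ (pairedCells-final T)

  invariant : Invariant T P
  invariant = proj₂ (pairedCells-final T)

  open Invariant invariant

  free-lower⇒opener : ∀ x → occ T x i ≡ true → (x , i) ∈ᵇ P ≡ false → opener T x ≡ true
  free-lower⇒opener x lower free with ∈ᵇ-cases (x , suc i) T
  ... | inj₂ no-upper = opener-intro T x lower no-upper
  ... | inj₁ upper = ⊥-elim (true≢false (proj₁ (vertical-paired x lower upper)) free)

  free-upper⇒closer : ∀ x → occ T x (suc i) ≡ true → (x , suc i) ∈ᵇ P ≡ false → closer T x ≡ true
  free-upper⇒closer x upper free with ∈ᵇ-cases (x , i) T
  ... | inj₂ no-lower = closer-intro T x upper no-lower
  ... | inj₁ lower = ⊥-elim (true≢false (proj₂ (vertical-paired x lower upper)) free)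

  ineligible : ∀ a b → (a , i) ∈ T → (b , suc i) ∈ T → eligible i T P (a , b) ≡ false
  ineligible a b a∈T b∈T with eligible i T P (a , b) in e
  ... | false = refl
  ... | true with subst (λ L → (a , b) ∈ L) saturated
                    (∈-filterᵇ⁺ (eligible i T P) (candidates i T) (a , b)
                      (pairs⁺ (rowCols i T) (rowCols (suc i) T) a b
                              (rowCols⁺ i T a a∈T) (rowCols⁺ (suc i) T b b∈T)) e)
  ... | ()

  blocking-cell : ∀ a b → opener T a ≡ true → (a , i) ∈ᵇ P ≡ false →
                  closer T b ≡ true → (b , suc i) ∈ᵇ P ≡ false → a < b →
                  Σ ℕ λ z → a < z × z < b ×
                    ((occ T z i ≡ true × (z , i) ∈ᵇ P ≡ false)
                     ⊎ (occ T z (suc i) ≡ true × (z , suc i) ∈ᵇ P ≡ false))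
  blocking-cell a b a-opener a-free b-closer b-free a<b
    with all-false _ T (Step.ineligible⁻ T P a b a<b a-free b-free
                         (ineligible a b (∈ᵇ⇒∈ _ _ (∧-true-l a-opener)) (∈ᵇ⇒∈ _ _ (∧-true-l b-closer))))
  ... | (z , r) , z∈T , test
    with ∨-false {not (((r ≡ᵇ i) ∨ (r ≡ᵇ suc i)) ∧ (a <ᵇ z) ∧ (z <ᵇ b))} test
  ... | in-range , z-free with not-false in-range
  ... | range = z , <ᵇ⇒< a z (∧-true-l range′) , <ᵇ⇒< z b (∧-true-r {a <ᵇ z} range′) , row-case
    where
    range′ : ((a <ᵇ z) ∧ (z <ᵇ b)) ≡ true
    range′ = ∧-true-r {(r ≡ᵇ i) ∨ (r ≡ᵇ suc i)} range
    row-case : (occ T z i ≡ true × (z , i) ∈ᵇ P ≡ false)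
               ⊎ (occ T z (suc i) ≡ true × (z , suc i) ∈ᵇ P ≡ false)
    row-case with ∨-true {r ≡ᵇ i} (∧-true-l range)
    ... | inj₁ r≡i rewrite ≡ᵇ⇒≡ r i r≡i = inj₁ (∈⇒∈ᵇ _ _ z∈T , z-free)
    ... | inj₂ r≡1+i rewrite ≡ᵇ⇒≡ r (suc i) r≡1+i = inj₂ (∈⇒∈ᵇ _ _ z∈T , z-free)

  -- Every free closer lies to the left of every free opener; the proof
  -- descends through blocking cells, n bounding the distance b - a.
  free-closers-precede : ∀ n a b → b ≤ a + n → opener T a ≡ true → (a , i) ∈ᵇ P ≡ false →
                         closer T b ≡ true → (b , suc i) ∈ᵇ P ≡ false → ¬ (a < b)
  free-closers-precede zero a b b≤a+0 _ _ _ _ a<b =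
    ℕₚ.<-irrefl refl (ℕₚ.<-≤-trans a<b (ℕₚ.≤-trans b≤a+0 (ℕₚ.≤-reflexive (ℕₚ.+-identityʳ a))))
  free-closers-precede (suc n) a b b≤a+1+n a-opener a-free b-closer b-free a<b
    with blocking-cell a b a-opener a-free b-closer b-free a<b
  ... | z , a<z , z<b , inj₁ (lower , z-free) =
    free-closers-precede n z b
      (ℕₚ.≤-trans b≤a+1+n (ℕₚ.≤-trans (ℕₚ.≤-reflexive (ℕₚ.+-suc a n)) (ℕₚ.+-monoˡ-≤ n a<z)))
      (free-lower⇒opener z lower z-free) z-free b-closer b-free z<b
  ... | z , a<z , z<b , inj₂ (upper , z-free) =
    free-closers-precede n a z
      (ℕₚ.≤-pred (ℕₚ.≤-trans z<b (ℕₚ.≤-trans b≤a+1+n (ℕₚ.≤-reflexive (ℕₚ.+-suc a n)))))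
      a-opener a-free (free-upper⇒closer z upper z-free) z-free a<z

  no-free-opener-before-free-closer : ∀ a b → opener T a ≡ true → (a , i) ∈ᵇ P ≡ false →
                                      closer T b ≡ true → (b , suc i) ∈ᵇ P ≡ false → ¬ (a < b)
  no-free-opener-before-free-closer a b = free-closers-precede b a b (ℕₚ.m≤n+m b a)

  data FreeView (x : ℕ) : Set where
    balanced    : wFree T P x ≡ 0ℤ → FreeView x
    free-opener : wFree T P x ≡ 1ℤ → opener T x ≡ true → (x , i) ∈ᵇ P ≡ false →
                  wPaired T P x ≡ 0ℤ → FreeView x
    free-closer : wFree T P x ≡ -1ℤ → closer T x ≡ true → (x , suc i) ∈ᵇ P ≡ false →
                  wPaired T P x ≡ 0ℤ → FreeView x

  freeView : ∀ x → FreeView x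
  freeView x with opener T x in o | closer T x in c | (x , i) ∈ᵇ P in m | (x , suc i) ∈ᵇ P in n
  ... | true  | _     | true  | _     = balanced (wFree-at T P x o c m n)
  ... | true  | _     | false | _     = free-opener (wFree-at T P x o c m n) o m (wPaired-at T P x o c m n)
  ... | false | true  | _     | true  = balanced (wFree-at T P x o c m n)
  ... | false | true  | _     | false = free-closer (wFree-at T P x o c m n) c n (wPaired-at T P x o c m n)
  ... | false | false | _     | _     = balanced (wFree-at T P x o c m n)

  free-column-level : ∀ x → wFree T P x ≢ 0ℤ → HPaired T P x ≡ 0ℤ × HPaired T P (suc x) ≡ 0ℤ
  free-column-level x wFree≢0 with freeView x
  ... | balanced wFree≡0 = ⊥-elim (wFree≢0 wFree≡0)
  ... | free-opener _ x-opener x-free wPaired≡0 = level , cong₂ ℤ._+_ level wPaired≡0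
    where
    level : HPaired T P x ≡ 0ℤ
    level = level-at-free-opener x x-opener x-free
  ... | free-closer _ x-closer x-free wPaired≡0 = level , cong₂ ℤ._+_ level wPaired≡0
    where
    level : HPaired T P x ≡ 0ℤ
    level = level-at-free-closer x x-closer x-free

  HFree≤H : ∀ y → HFree T P y ℤ.≤ H T y
  HFree≤H y = ℤₚ.≤-trans (ℤₚ.≤-trans (ℤₚ.≤-reflexive (sym (ℤₚ.+-identityˡ _)))
                                     (ℤₚ.+-monoˡ-≤ (HFree T P y) (paired-nonneg y)))
                         (ℤₚ.≤-reflexive (sym (H-split T P y)))

  H-at-level : ∀ y → HPaired T P y ≡ 0ℤ → H T y ≡ HFree T P y
  H-at-level y level = trans (H-split T P y) (trans (cong (λ d → d ℤ.+ HFree T P y) level) (ℤₚ.+-identityˡ _))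

  -- Right of a free opener the free weights are ≥ 0 (no free closer there).
  free-opener-rises : ∀ a → opener T a ≡ true → (a , i) ∈ᵇ P ≡ false → RisesAfter T a
  free-opener-rises a a-opener a-free y a<y = begin-strict
    H T a                   ≡⟨ H-at-level a (level-at-free-opener a a-opener a-free) ⟩
    HFree T P a             <⟨ i<i+1 (HFree T P a) ⟩
    HFree T P a ℤ.+ 1ℤ      ≡⟨ cong (λ d → HFree T P a ℤ.+ d) (sym (wFree-at T P a a-opener refl a-free refl)) ⟩
    HFree T P (suc a)       ≤⟨ psum-increasing (wFree T P) (suc a) y a<y nonneg ⟩
    HFree T P y             ≤⟨ HFree≤H y ⟩
    H T y                   ∎
    where
    open ℤₚ.≤-Reasoning
    nonneg : ∀ x → suc a ≤ x → x < y → 0ℤ ℤ.≤ wFree T P x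
    nonneg x a<x _ with freeView x
    ... | balanced e = ℤₚ.≤-reflexive (sym e)
    ... | free-opener e _ _ _ = ℤₚ.≤-trans (ℤ.+≤+ z≤n) (ℤₚ.≤-reflexive (sym e))
    ... | free-closer _ x-closer x-free _ =
      ⊥-elim (no-free-opener-before-free-closer a x a-opener a-free x-closer x-free a<x)

  -- Left of a free closer the free weights are ≤ 0 (no free opener there).
  free-closer-falls : ∀ b → closer T b ≡ true → (b , suc i) ∈ᵇ P ≡ false → FallsBefore T b
  free-closer-falls b b-closer b-free y y≤b = begin-strict
    H T (suc b)             ≡⟨ H-at-level (suc b) (proj₂ (free-column-level b wFree≢0)) ⟩
    HFree T P b ℤ.+ wFree T P b ≡⟨ cong (λ d → HFree T P b ℤ.+ d) wFree≡-1 ⟩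
    HFree T P b ℤ.+ -1ℤ     <⟨ i-1<i (HFree T P b) ⟩
    HFree T P b             ≤⟨ psum-decreasing (wFree T P) y b y≤b nonpos ⟩
    HFree T P y             ≤⟨ HFree≤H y ⟩
    H T y                   ∎
    where
    open ℤₚ.≤-Reasoning
    wFree≡-1 : wFree T P b ≡ -1ℤ
    wFree≡-1 = wFree-at T P b (opener-upper T b (∧-true-l b-closer)) b-closer refl b-free
    wFree≢0 : wFree T P b ≢ 0ℤ
    wFree≢0 e with trans (sym wFree≡-1) e
    ... | ()
    nonpos : ∀ x → y ≤ x → x < b → wFree T P x ℤ.≤ 0ℤ
    nonpos x _ x<b with freeView x
    ... | balanced e = ℤₚ.≤-reflexive e
    ... | free-opener _ x-opener x-free _ =
      ⊥-elim (no-free-opener-before-free-closer x b x-opener x-free b-closer b-free x<b)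
    ... | free-closer e _ _ _ = ℤₚ.≤-trans (ℤₚ.≤-reflexive e) ℤ.-≤+

  -- If a paired opener a rose to the right, the free height would be
  -- constant right of a, and beyond the last column the height would be
  -- back at most at H(a).
  paired-opener-¬rises : ∀ a → opener T a ≡ true → (a , i) ∈ᵇ P ≡ true → ¬ RisesAfter T a
  paired-opener-¬rises a a-opener a-paired rises =
    ℤₚ.<⇒≱ (rises (bound T) a<bound) (begin
      H T (bound T)                   ≡⟨ H-at-level (bound T) level-at-bound ⟩
      HFree T P (bound T)             ≡⟨ cong (HFree T P) (sym k+a≡bound) ⟩
      HFree T P (bound T ∸ a + a)     ≡⟨ flat (bound T ∸ a) ⟩
      HFree T P a                     ≤⟨ HFree≤H a ⟩
      H T a                           ∎)
    where
    open ℤₚ.≤-Reasoning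
    a<bound : a < bound T
    a<bound = bound-> T a i (∈ᵇ⇒∈ _ _ (∧-true-l a-opener))
    k+a≡bound : bound T ∸ a + a ≡ bound T
    k+a≡bound = ℕₚ.m∸n+n≡m (ℕₚ.<⇒≤ a<bound)
    no-free-weight : ∀ k → HFree T P (k + a) ≡ HFree T P a → wFree T P (k + a) ≡ 0ℤ
    no-free-weight zero    _     = wFree-at T P a a-opener refl a-paired refl
    no-free-weight (suc k) flat-k with wFree T P (suc k + a) ℤₚ.≟ 0ℤ
    ... | yes wFree≡0 = wFree≡0
    ... | no  wFree≢0 = ⊥-elim (ℤₚ.<⇒≱ (rises (suc k + a) (s≤s (ℕₚ.m≤n+m a k)))
            (ℤₚ.≤-trans (ℤₚ.≤-reflexive
                          (trans (H-at-level (suc k + a) (proj₁ (free-column-level _ wFree≢0))) flat-k))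
                        (HFree≤H a)))
    flat : ∀ k → HFree T P (k + a) ≡ HFree T P a
    flat zero    = refl
    flat (suc k) = trans (cong (λ d → HFree T P (k + a) ℤ.+ d) (no-free-weight k (flat k)))
                         (trans (ℤₚ.+-identityʳ _) (flat k))

  -- Symmetrically, if a paired closer b fell to its left, the free height
  -- would be constant on [0 , b + 1] and H(b + 1) ≥ H(0) would follow.
  paired-closer-¬falls : ∀ b → closer T b ≡ true → (b , suc i) ∈ᵇ P ≡ true → ¬ FallsBefore T b
  paired-closer-¬falls b b-closer b-paired falls =
    ℤₚ.<⇒≱ (falls 0 z≤n) (begin
      H T 0                 ≡⟨ flat (suc b) 0 refl ⟩
      HFree T P (suc b)     ≤⟨ HFree≤H (suc b) ⟩
      H T (suc b)           ∎)
    where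
    open ℤₚ.≤-Reasoning
    no-free-weight : ∀ d y → suc y + d ≡ suc b → HFree T P (suc y) ≡ HFree T P (suc b) →
               wFree T P y ≡ 0ℤ
    no-free-weight zero y e _ with ℕₚ.suc-injective (trans (sym (ℕₚ.+-identityʳ (suc y))) e)
    ... | refl = wFree-at T P y (opener-upper T y (∧-true-l b-closer)) b-closer refl b-paired
    no-free-weight (suc d) y e flat-y with wFree T P y ℤₚ.≟ 0ℤ
    ... | yes wFree≡0 = wFree≡0
    ... | no  wFree≢0 = ⊥-elim (ℤₚ.<⇒≱ (falls (suc y) 1+y≤b)
            (ℤₚ.≤-trans (ℤₚ.≤-reflexive
                          (trans (H-at-level (suc y) (proj₂ (free-column-level y wFree≢0))) flat-y))
                        (HFree≤H (suc b))))
      where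
      1+y≤b : suc y ≤ b
      1+y≤b = ℕₚ.≤-trans (s≤s (ℕₚ.m≤m+n y d))
                         (ℕₚ.≤-reflexive (trans (sym (ℕₚ.+-suc y d)) (ℕₚ.suc-injective e)))
    flat : ∀ d y → y + d ≡ suc b → HFree T P y ≡ HFree T P (suc b)
    flat zero    y e = cong (HFree T P) (trans (sym (ℕₚ.+-identityʳ y)) e)
    flat (suc d) y e = trans (sym (trans (cong (λ u → HFree T P y ℤ.+ u) (no-free-weight d y e′ flat′))
                                         (ℤₚ.+-identityʳ _)))
                             flat′
      where
      e′ : suc y + d ≡ suc b
      e′ = trans (sym (ℕₚ.+-suc y d)) e
      flat′ : HFree T P (suc y) ≡ HFree T P (suc b)
      flat′ = flat d (suc y) e′

  free-opener⇔rises : ∀ a → opener T a ≡ true → ((a , i) ∈ᵇ P ≡ false ⇔ RisesAfter T a)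
  free-opener⇔rises a a-opener = mk⇔ (free-opener-rises a a-opener) free
    where
    free : RisesAfter T a → (a , i) ∈ᵇ P ≡ false
    free rises with ∈ᵇ-cases (a , i) P
    ... | inj₂ a-free   = a-free
    ... | inj₁ a-paired = ⊥-elim (paired-opener-¬rises a a-opener a-paired rises)

  free-closer⇔falls : ∀ b → closer T b ≡ true → ((b , suc i) ∈ᵇ P ≡ false ⇔ FallsBefore T b)
  free-closer⇔falls b b-closer = mk⇔ (free-closer-falls b b-closer) free
    where
    free : FallsBefore T b → (b , suc i) ∈ᵇ P ≡ false
    free falls with ∈ᵇ-cases (b , suc i) P
    ... | inj₂ b-free   = b-free
    ... | inj₁ b-paired = ⊥-elim (paired-closer-¬falls b b-closer b-paired falls)

module MoveDown (i c : ℕ) where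

  moveDown-other : ∀ T x r → x ≢ c → (x , r) ∈ᵇ moveDown i c T ≡ (x , r) ∈ᵇ T
  moveDown-other []      x r x≢c = refl
  moveDown-other (y ∷ T) x r x≢c with eqCellᵇ y (c , suc i) in e
  ... | true with eqCell⇒≡ y _ e
  ... | refl rewrite eqCell-col≢ x c r i x≢c | eqCell-col≢ x c r (suc i) x≢c =
    moveDown-other T x r x≢c
  moveDown-other (y ∷ T) x r x≢c | false rewrite moveDown-other T x r x≢c = refl

  moveDown-vacates : ∀ T → (c , suc i) ∈ᵇ moveDown i c T ≡ false
  moveDown-vacates []      = refl
  moveDown-vacates (y ∷ T) with eqCellᵇ y (c , suc i) in e
  ... | true  rewrite eqCell-row≢ c c (suc i) i (suc≢ i) = moveDown-vacates T
  ... | false rewrite eqCell-sym-false y _ e = moveDown-vacates T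

  moveDown-fills : ∀ T → (c , suc i) ∈ T → (c , i) ∈ᵇ moveDown i c T ≡ true
  moveDown-fills (y ∷ T) (here refl) rewrite eqCell-refl (c , suc i) | eqCell-refl (c , i) = refl
  moveDown-fills (y ∷ T) (there m) rewrite moveDown-fills T m = ∨-true-r _

¬IPaired⇒free : ∀ i T x → x ∈ T → ¬ IPaired i T x → x ∈ᵇ pairedCells i T ≡ false
¬IPaired⇒free i T x x∈T unpaired with ∈ᵇ-cases x (pairedCells i T)
... | inj₂ free   = free
... | inj₁ paired = ⊥-elim (unpaired (x∈T , ∈ᵇ⇒∈ _ _ paired))

module Raising (i : ℕ) (T : Diagram) (c : ℕ) (raises-c : raiseCol i T ≡ just c) where
  open Heights i
  open MoveDown i c
  module A = FinalPairing i T

  T′ : Diagram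
  T′ = moveDown i c T

  module B = FinalPairing i T′

  private
    free-upper : ℕ → Bool
    free-upper b = not ((b , suc i) ∈ᵇ pairedCells i T)

    c-max : c ∈ filterᵇ free-upper (rowCols (suc i) T)
            × (∀ b → b ∈ filterᵇ free-upper (rowCols (suc i) T) → b ≤ c)
    c-max = maxMaybe-max (filterᵇ free-upper (rowCols (suc i) T)) c raises-c
    c-free-upper : c ∈ rowCols (suc i) T × free-upper c ≡ true
    c-free-upper = ∈-filterᵇ⁻ free-upper (rowCols (suc i) T) c (proj₁ c-max)

  c-upper : (c , suc i) ∈ T
  c-upper = rowCols⁻ (suc i) T c (proj₁ c-free-upper)

  c-free : (c , suc i) ∈ᵇ A.P ≡ false
  c-free = not-true (proj₂ c-free-upper)

  rightmost : ∀ b → (b , suc i) ∈ T → (b , suc i) ∈ᵇ A.P ≡ false → b ≤ c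
  rightmost b b∈T b-free = proj₂ c-max b
    (∈-filterᵇ⁺ free-upper (rowCols (suc i) T) b (rowCols⁺ (suc i) T b b∈T) (false⇒not-true b-free))

  c-closer : closer T c ≡ true
  c-closer = A.free-upper⇒closer c (∈⇒∈ᵇ _ _ c-upper) c-free

  c-opener : opener T c ≡ false
  c-opener = opener-upper T c (∈⇒∈ᵇ _ _ c-upper)

  c-opener′ : opener T′ c ≡ true
  c-opener′ = opener-intro T′ c (moveDown-fills T c-upper) (moveDown-vacates T)

  opener-other : ∀ x → x ≢ c → opener T′ x ≡ opener T x
  opener-other x x≢c rewrite moveDown-other T x i x≢c | moveDown-other T x (suc i) x≢c = refl

  closer-other : ∀ x → x ≢ c → closer T′ x ≡ closer T x
  closer-other x x≢c rewrite moveDown-other T x i x≢c | moveDown-other T x (suc i) x≢c = refl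

  -- The weight of column c changes from -1 to +1, so the height grows by 2
  -- strictly right of c.
  w-change : ∀ x → w T′ x ≡ w T x ℤ.+ pulse c (ℤ.+ 2) x
  w-change x with x ℕₚ.≟ c
  ... | yes refl = trans (w-at T′ c c-opener′ refl)
                         (sym (cong₂ ℤ._+_ (w-at T c c-opener c-closer) (pulse-at c (ℤ.+ 2))))
  ... | no x≢c = trans (cong₂ weight (opener-other x x≢c) (closer-other x x≢c))
                       (sym (trans (cong (λ d → w T x ℤ.+ d) (pulse-off c (ℤ.+ 2) x x≢c))
                                   (ℤₚ.+-identityʳ _)))

  H-before : ∀ y → y ≤ c → H T′ y ≡ H T y
  H-before y y≤c = trans (psum-+ _ _ _ w-change y)
                         (trans (cong (λ d → H T y ℤ.+ d) (psum-pulse-before c _ y y≤c))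
                                (ℤₚ.+-identityʳ _))

  H-after : ∀ y → c < y → H T′ y ≡ H T y ℤ.+ ℤ.+ 2
  H-after y c<y = trans (psum-+ _ _ _ w-change y)
                        (cong (λ d → H T y ℤ.+ d) (psum-pulse-after c _ y c<y))

  same-<-before : ∀ y z → y ≤ c → z ≤ c → (H T y ℤ.< H T z ⇔ H T′ y ℤ.< H T′ z)
  same-<-before y z y≤c z≤c rewrite H-before y y≤c | H-before z z≤c = mk⇔ (λ p → p) (λ p → p)

  same-<-after : ∀ y z → c < y → c < z → (H T y ℤ.< H T z ⇔ H T′ y ℤ.< H T′ z)
  same-<-after y z c<y c<z rewrite H-after y c<y | H-after z c<z = +-<⇔ (ℤ.+ 2) (H T y) (H T z)

  -- Since c is a free closer, H(c + 1) lies below all heights up to c ...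
  falls-at-c : FallsBefore T c
  falls-at-c = A.free-closer-falls c c-closer c-free

  H-at-c : H T c ≡ H T (suc c) ℤ.+ 1ℤ
  H-at-c = begin
    H T c                             ≡⟨ sym (ℤₚ.+-identityʳ (H T c)) ⟩
    H T c ℤ.+ (-1ℤ ℤ.+ 1ℤ)            ≡⟨ sym (ℤₚ.+-assoc (H T c) -1ℤ 1ℤ) ⟩
    (H T c ℤ.+ -1ℤ) ℤ.+ 1ℤ            ≡⟨ cong (λ d → (H T c ℤ.+ d) ℤ.+ 1ℤ) (sym (w-at T c c-opener c-closer)) ⟩
    H T (suc c) ℤ.+ 1ℤ                ∎
    where open ≡-Reasoning

  H-c-below : ∀ x → x ≤ c → H T c ℤ.≤ H T x
  H-c-below x x≤c = subst (λ h → h ℤ.≤ H T x) (sym H-at-c) (<⇒+1≤ (falls-at-c x x≤c))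

  -- ... and, since every closer right of c is paired, H never drops below
  -- H(c + 1) again (strong induction on the column).
  stays-above : ∀ y → c < y → H T (suc c) ℤ.≤ H T y
  stays-above = <-rec (λ y → c < y → H T (suc c) ℤ.≤ H T y) step
    where
    step : ∀ y → (∀ {z} → z < y → c < z → H T (suc c) ℤ.≤ H T z) → c < y → H T (suc c) ℤ.≤ H T y
    step (suc b) ih c<1+b with ℕₚ.m≤n⇒m<n∨m≡n (ℕₚ.≤-pred c<1+b)
    ... | inj₂ refl = ℤₚ.≤-refl
    ... | inj₁ c<b with true-or-false (closer T b)
    ...   | inj₂ b-not-closer = ℤₚ.≤-trans (ih ℕₚ.≤-refl c<b) (H-step-up T b b-not-closer)
    ...   | inj₁ b-closer with H T (suc c) ℤₚ.≤? H T (suc b)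
    ...     | yes above = above
    ...     | no below = ⊥-elim (true≢false b-paired b-free)
      where
      b-paired : (b , suc i) ∈ᵇ A.P ≡ true
      b-paired with ∈ᵇ-cases (b , suc i) A.P
      ... | inj₁ paired = paired
      ... | inj₂ free = ⊥-elim (ℕₚ.<⇒≱ c<b (rightmost b (∈ᵇ⇒∈ _ _ (∧-true-l b-closer)) free))
      falls : FallsBefore T b
      falls y y≤b with ℕₚ.≤-<-connex y c
      ... | inj₁ y≤c = ℤₚ.<-trans (ℤₚ.≰⇒> below) (falls-at-c y y≤c)
      ... | inj₂ c<y = ℤₚ.<-≤-trans (ℤₚ.≰⇒> below) (ih (s≤s y≤b) c<y)
      b-free : (b , suc i) ∈ᵇ A.P ≡ false
      b-free = Equivalence.from (A.free-closer⇔falls b b-closer) falls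

  rises-same : ∀ x → x ≢ c → (RisesAfter T x ⇔ RisesAfter T′ x)
  rises-same x x≢c with ℕₚ.<-cmp x c
  ... | tri≈ _ x≡c _ = ⊥-elim (x≢c x≡c)
  ... | tri< x<c _ _ = mk⇔ (λ rises → ⊥-elim (no-rise rises)) (λ rises′ → ⊥-elim (no-rise′ rises′))
    where
    -- left of c the height comes back down to H(c + 1) < H(x), resp. to H(c) ≤ H(x)
    no-rise : ¬ RisesAfter T x
    no-rise rises = ℤₚ.<-asym (rises (suc c) (ℕₚ.m≤n⇒m≤1+n x<c)) (falls-at-c x (ℕₚ.<⇒≤ x<c))
    no-rise′ : ¬ RisesAfter T′ x
    no-rise′ rises′ = ℤₚ.<⇒≱ (Equivalence.from (same-<-before x c (ℕₚ.<⇒≤ x<c) ℕₚ.≤-refl) (rises′ c x<c))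
                             (H-c-below x (ℕₚ.<⇒≤ x<c))
  ... | tri> _ _ c<x = mk⇔
    (λ rises  y x<y → Equivalence.to   (same-<-after x y c<x (ℕₚ.<-trans c<x x<y)) (rises y x<y))
    (λ rises′ y x<y → Equivalence.from (same-<-after x y c<x (ℕₚ.<-trans c<x x<y)) (rises′ y x<y))

  falls-same : ∀ x → x ≢ c → (FallsBefore T x ⇔ FallsBefore T′ x)
  falls-same x x≢c with ℕₚ.<-cmp x c
  ... | tri≈ _ x≡c _ = ⊥-elim (x≢c x≡c)
  ... | tri< x<c _ _ = mk⇔
    (λ falls  y y≤x → Equivalence.to   (same-<-before (suc x) y x<c (y≤c y≤x)) (falls y y≤x))
    (λ falls′ y y≤x → Equivalence.from (same-<-before (suc x) y x<c (y≤c y≤x)) (falls′ y y≤x))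
    where
    y≤c : ∀ {y} → y ≤ x → y ≤ c
    y≤c y≤x = ℕₚ.≤-trans y≤x (ℕₚ.<⇒≤ x<c)
  ... | tri> _ _ c<x = mk⇔ (λ falls → ⊥-elim (no-fall falls)) (λ falls′ → ⊥-elim (no-fall′ falls′))
    where
    -- right of c the height never drops below H(c + 1)
    c<1+x : c < suc x
    c<1+x = ℕₚ.m≤n⇒m≤1+n c<x
    no-fall : ¬ FallsBefore T x
    no-fall falls = ℤₚ.<⇒≱ (falls (suc c) c<x) (stays-above (suc x) c<1+x)
    no-fall′ : ¬ FallsBefore T′ x
    no-fall′ falls′ = ℤₚ.<⇒≱ (Equivalence.from (same-<-after (suc x) (suc c) c<1+x (ℕₚ.n<1+n c))
                                                  (falls′ (suc c) c<x))
                             (stays-above (suc x) c<1+x)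

  paired-same : ∀ x r → r ≡ i ⊎ r ≡ suc i → (x , r) ∈ T → x ≢ c →
                (x , r) ∈ᵇ A.P ≡ (x , r) ∈ᵇ B.P
  paired-same x r (inj₁ refl) x∈T x≢c with true-or-false (occ T x (suc i))
  ... | inj₁ upper = trans (proj₁ (Invariant.vertical-paired A.invariant x lower upper))
                           (sym (proj₁ (Invariant.vertical-paired B.invariant x
                                  (trans (moveDown-other T x i x≢c) lower)
                                  (trans (moveDown-other T x (suc i) x≢c) upper))))
    where
    lower : occ T x i ≡ true
    lower = ∈⇒∈ᵇ _ _ x∈T
  ... | inj₂ no-upper = false-equivalent (⇔.trans (A.free-opener⇔rises x x-opener)
                          (⇔.trans (rises-same x x≢c)
                            (⇔.sym (B.free-opener⇔rises x (trans (opener-other x x≢c) x-opener)))))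
    where
    x-opener : opener T x ≡ true
    x-opener = opener-intro T x (∈⇒∈ᵇ _ _ x∈T) no-upper
  paired-same x r (inj₂ refl) x∈T x≢c with true-or-false (occ T x i)
  ... | inj₁ lower = trans (proj₂ (Invariant.vertical-paired A.invariant x lower upper))
                           (sym (proj₂ (Invariant.vertical-paired B.invariant x
                                  (trans (moveDown-other T x i x≢c) lower)
                                  (trans (moveDown-other T x (suc i) x≢c) upper))))
    where
    upper : occ T x (suc i) ≡ true
    upper = ∈⇒∈ᵇ _ _ x∈T
  ... | inj₂ no-lower = false-equivalent (⇔.trans (A.free-closer⇔falls x x-closer)
                          (⇔.trans (falls-same x x≢c)
                            (⇔.sym (B.free-closer⇔falls x (trans (closer-other x x≢c) x-closer)))))
    where
    x-closer : closer T x ≡ true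
    x-closer = closer-intro T x (∈⇒∈ᵇ _ _ x∈T) no-lower

  pairing-preserved : ∀ x r → r ≡ i ⊎ r ≡ suc i → (x , r) ∈ T →
                      (IPaired i T (x , r) ⇔ ((x , r) ∈ T′ × IPaired i T′ (x , r)))
  pairing-preserved x r row x∈T with x ℕₚ.≟ c
  pairing-preserved x r (inj₁ refl) x∈T | yes refl =
    ⊥-elim (true≢false (∈⇒∈ᵇ _ _ x∈T) (not-true (∧-true-r {occ T c (suc i)} c-closer)))
  pairing-preserved x r (inj₂ refl) x∈T | yes refl = mk⇔
    (λ paired → ⊥-elim (∈ᵇ-false⇒∉ _ _ c-free (proj₂ paired)))
    (λ kept → ⊥-elim (∈ᵇ-false⇒∉ _ _ (moveDown-vacates T) (proj₁ kept)))
  pairing-preserved x r row x∈T | no x≢c = mk⇔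
    (λ paired → x∈T′ , x∈T′ , ∈ᵇ⇒∈ _ _ (trans (sym same) (∈⇒∈ᵇ _ _ (proj₂ paired))))
    (λ kept → x∈T , ∈ᵇ⇒∈ _ _ (trans same (∈⇒∈ᵇ _ _ (proj₂ (proj₂ kept)))))
    where
    x∈T′ : (x , r) ∈ T′
    x∈T′ = ∈ᵇ⇒∈ _ _ (trans (moveDown-other T x r x≢c) (∈⇒∈ᵇ _ _ x∈T))
    same : (x , r) ∈ᵇ A.P ≡ (x , r) ∈ᵇ B.P
    same = paired-same x r row x∈T x≢c

  rises-at-c : RisesAfter T′ c
  rises-at-c y c<y = begin-strict
    H T′ c                        ≡⟨ H-before c ℕₚ.≤-refl ⟩
    H T c                         <⟨ i<i+1 (H T c) ⟩
    H T c ℤ.+ 1ℤ                  ≡⟨ ℤₚ.+-assoc (H T c) -1ℤ (ℤ.+ 2) ⟨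
    (H T c ℤ.+ -1ℤ) ℤ.+ ℤ.+ 2     ≡⟨ cong (λ d → (H T c ℤ.+ d) ℤ.+ ℤ.+ 2) (w-at T c c-opener c-closer) ⟨
    H T (suc c) ℤ.+ ℤ.+ 2         ≤⟨ ℤₚ.+-monoˡ-≤ (ℤ.+ 2) (stays-above y c<y) ⟩
    H T y ℤ.+ ℤ.+ 2               ≡⟨ H-after y c<y ⟨
    H T′ y                        ∎
    where open ℤₚ.≤-Reasoning

  c-unpaired : ¬ IPaired i T′ (c , i)
  c-unpaired (_ , paired) =
    true≢false (∈⇒∈ᵇ _ _ paired) (Equivalence.from (B.free-opener⇔rises c c-opener′) rises-at-c)

  c-leftmost : ∀ c′ → (c′ , i) ∈ T′ → ¬ IPaired i T′ (c′ , i) → c ≤ c′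
  c-leftmost c′ c′∈T′ unpaired with c ℕₚ.≤? c′
  ... | yes c≤c′ = c≤c′
  ... | no c≰c′ = ⊥-elim (ℤₚ.<⇒≱ rise (begin
      H T′ c     ≡⟨ H-before c ℕₚ.≤-refl ⟩
      H T c      ≤⟨ H-c-below c′ (ℕₚ.<⇒≤ c′<c) ⟩
      H T c′     ≡⟨ H-before c′ (ℕₚ.<⇒≤ c′<c) ⟨
      H T′ c′    ∎))
    where
    open ℤₚ.≤-Reasoning
    c′<c : c′ < c
    c′<c = ℕₚ.≰⇒> c≰c′
    c′-free : (c′ , i) ∈ᵇ B.P ≡ false
    c′-free = ¬IPaired⇒free i T′ (c′ , i) c′∈T′ unpaired
    c′-opener : opener T′ c′ ≡ true
    c′-opener = B.free-lower⇒opener c′ (∈⇒∈ᵇ _ _ c′∈T′) c′-free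
    rise : H T′ c′ ℤ.< H T′ c
    rise = Equivalence.to (B.free-opener⇔rises c′ c′-opener) c′-free c c′<c

𝔢-raises : ∀ i T T′ → 𝔢 i T ≡ just T′ → Σ ℕ λ c → raiseCol i T ≡ just c × moveDown i c T ≡ T′
𝔢-raises i T T′ e with raiseCol i T
𝔢-raises i T T′ refl | just c = c , refl , refl

lemma4p3 : (T : Diagram) → IsDiagram T → (i : ℕ) → 1 ≤ i →
    (T' : Diagram) → 𝔢 i T ≡ just T' →
    ((c r : ℕ) → (r ≡ i ⊎ r ≡ suc i) → (c , r) ∈ T →
      (IPaired i T (c , r) ⇔ ((c , r) ∈ T' × IPaired i T' (c , r))))
    × ((c : ℕ) → raiseCol i T ≡ just c →
      (c , i) ∈ T' × ¬ IPaired i T' (c , i)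
      × ((c' : ℕ) → (c' , i) ∈ T' → ¬ IPaired i T' (c' , i) → c ≤ c'))
lemma4p3 T _ i _ T′ raised with 𝔢-raises i T T′ raised
... | c , raises-c , refl = Raising.pairing-preserved i T c raises-c , leftmost-unpaired
  where
  leftmost-unpaired : (c′ : ℕ) → raiseCol i T ≡ just c′ →
    (c′ , i) ∈ T′ × ¬ IPaired i T′ (c′ , i)
    × ((c″ : ℕ) → (c″ , i) ∈ T′ → ¬ IPaired i T′ (c″ , i) → c′ ≤ c″)
  leftmost-unpaired c′ raises-c′ with trans (sym raises-c) raises-c′
  ... | refl = ∈ᵇ⇒∈ _ _ (MoveDown.moveDown-fills i c T c-upper) , c-unpaired , c-leftmost
    where open Raising i T c raises-c
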